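{- Let $0\le t\le m\le n$, $m\ge1$. The graph $K_{m,n}^{t}$ is connected and of QE class if and only if it is one of the following: $K_{1,n}$ ($n\ge1$, $t=0$), $K_{2,2}$, $K_{2,2}^{1}$, $K_{2,3}^{1}$, $K_{2,3}^{2}$, $K_{2,4}^{2}$, $K_{3,3}^{2}$, $K_{3,3}^{3}$, $K_{3,4}^{3}$, $K_{4,4}^{4}$.
   Context: $K_{m,n}^{t}$ has vertex set $\{u_1,\dots,u_m,v_1,\dots,v_n\}$ and edge set $\{\{u_i,v_j\}: 1\le i\le m,\ 1\le j\le n,\ \text{and if } i=j \text{ then } i>t\}$; $K_{m,n}=K_{m,n}^0$. A finite connected graph with graph distance $d$ is of QE class if there exist a real Hilbert space $\mathcal H$ and a map $\varphi$ from its vertices to $\mathcal H$ with $\|\varphi(x)-\varphi(y)\|^2=d(x,y)$ for all vertices $x,y$ (equivalently, the distance matrix $D$ satisfies $f^\top Df\le0$ whenever $\mathbf 1^\top f=0$).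
   Formalization: The vectors f with $\mathbf 1^\top f=0$ in the distance-matrix criterion for QE class have rational entries. -}

module Defs where

open import Data.Nat using (ℕ; zero; suc; _≤_)
open import Data.Fin using (Fin; toℕ)
import Data.Fin as F
open import Data.Sum using (_⊎_; inj₁; inj₂)
open import Data.Product using (Σ; ∃; _×_; _,_)
open import Data.Unit using (⊤)
open import Data.Empty using (⊥)
open import Data.Integer using (+_)
open import Data.Rational using (ℚ; 0ℚ; _+_; _*_; _/_)
import Data.Rational as Q
open import Relation.Binary.PropositionalEquality using (_≡_)

-- Vertex set of K^t_{m,n}: inj₁ i = u_{i+1}, inj₂ j = v_{j+1} (0-based Fin indices).
Vertex : ℕ → ℕ → Set
Vertex m n = Fin m ⊎ Fin n

-- Adjacency of K^t_{m,n}: u_i ~ v_j iff (i = j implies i > t) (1-based),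
-- i.e. with 0-based indices: toℕ i ≡ toℕ j implies t ≤ toℕ i.
Adj : (m n t : ℕ) → Vertex m n → Vertex m n → Set
Adj m n t (inj₁ i) (inj₂ j) = toℕ i ≡ toℕ j → t ≤ toℕ i
Adj m n t (inj₂ j) (inj₁ i) = toℕ i ≡ toℕ j → t ≤ toℕ i
Adj m n t (inj₁ _) (inj₁ _) = ⊥
Adj m n t (inj₂ _) (inj₂ _) = ⊥

data Walk {V : Set} (A : V → V → Set) : V → V → ℕ → Set where
  here : ∀ {x} → Walk A x x zero
  step : ∀ {x y z k} → A x y → Walk A y z k → Walk A x z (suc k)

Connected : {V : Set} → (V → V → Set) → Set
Connected {V} A = (x y : V) → ∃ λ k → Walk A x y k

IsGraphDistance : {V : Set} → (V → V → Set) → (V → V → ℕ) → Set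
IsGraphDistance {V} A d =
  (x y : V) → Walk A x y (d x y) × ((k : ℕ) → Walk A x y k → d x y ≤ k)

sumFin : (n : ℕ) → (Fin n → ℚ) → ℚ
sumFin zero f = 0ℚ
sumFin (suc n) f = f F.zero + sumFin n (λ i → f (F.suc i))

sumV : (m n : ℕ) → (Vertex m n → ℚ) → ℚ
sumV m n f = sumFin m (λ i → f (inj₁ i)) + sumFin n (λ j → f (inj₂ j))

ℕ→ℚ : ℕ → ℚ
ℕ→ℚ k = + k / 1

-- QE class (via the distance matrix criterion): the graph distance d satisfies
-- Σ_{x,y} f(x) d(x,y) f(y) ≤ 0 for every f with Σ_x f(x) = 0.
QE-K : (m n t : ℕ) → Set
QE-K m n t = Σ (Vertex m n → Vertex m n → ℕ) λ d →
  IsGraphDistance (Adj m n t) d ×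
  ((f : Vertex m n → ℚ) → sumV m n f ≡ 0ℚ →
     sumV m n (λ x → sumV m n (λ y → f x * ℕ→ℚ (d x y) * f y)) Q.≤ 0ℚ)

data InList : ℕ → ℕ → ℕ → Set where
  star   : ∀ {n} → 1 ≤ n → InList 1 n 0
  k220   : InList 2 2 0
  k221   : InList 2 2 1
  k231   : InList 2 3 1
  k232   : InList 2 3 2
  k242   : InList 2 4 2
  k332   : InList 3 3 2
  k333   : InList 3 3 3
  k343   : InList 3 4 3
  k444   : InList 4 4 4

module Submission where

-- A distance d is conditionally negative definite as soon as it is a weighted squared Euclidean
-- distance d x y = ∑ₖ wₖ (φₖ x − φₖ y)² with wₖ ≥ 0: for ∑ f = 0 its quadratic form is
-- −2 ∑ₖ wₖ (∑ₓ f x φₖ x)². The stars K_{1,n} embed with the centre at 0 and the leaves at the unit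
-- vectors; the nine other listed graphs embed at explicit integer points, which is checked by
-- evaluation together with their graph distances.
--
-- Conversely, K^t_{m,n} is bipartite, so a side-preserving copy of K_{m′,n′} (m′, n′ ≥ 1) in it is
-- isometric, and QE class passes to K_{m′,n′}. But K_{2,3} is not of QE class: the weights 3 on
-- the two left and −2 on the three right vertices sum to 0 and give the quadratic form 12. Every
-- unlisted K^t_{m,n} with t ≤ m ≤ n is disconnected (K¹_{1,n} and K²_{2,2}) or contains such a
-- K_{2,3}; for n ≥ 5 take u₁, u₂ and v₃, v₄, v₅.

open import Defs
open import Algebra.Bundles using (Ring)
open import Data.Bool using (if_then_else_)
open import Data.Empty using (⊥; ⊥-elim)
open import Data.Fin as Fin using (Fin; splitAt; #_)
open import Data.Fin.Patterns using (0F; 1F)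
import Data.Fin.Properties as FinP
import Data.Integer as ℤ
open import Data.Nat as ℕ using (ℕ; zero; suc; _≤_; z≤n; s≤s)
import Data.Nat.Properties as ℕP
open import Data.Product using (∃; _×_; _,_; proj₁; proj₂)
open import Data.Rational as Q using (ℚ; 0ℚ; 1ℚ; _+_; _*_; -_; _-_; _/_) renaming (_≤_ to _≤ℚ_)
import Data.Rational.Properties as ℚ
open import Data.Sum as Sum using (_⊎_; inj₁; inj₂)
import Data.Sum.Properties as Sum
open import Data.Unit using (⊤; tt)
open import Data.Vec using (Vec; []; _∷_; lookup)
open import Function.Base using (_∘_; id)
open import Function.Bundles using (_⇔_; mk⇔)
open import Function.Definitions using (Injective)
open import Relation.Binary.PropositionalEquality
open import Relation.Nullary using (¬_; Dec; yes; no; does)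
open import Relation.Nullary.Decidable
  using (map′; True; toWitness; _×-dec_; _⊎-dec_; _→-dec_; ¬?; dec⇒maybe)
open import Tactic.RingSolver using (solve-∀)
open import Tactic.RingSolver.Core.AlmostCommutativeRing using (AlmostCommutativeRing; fromCommutativeRing)
open import Algebra.Properties.Semiring.Sum (Ring.semiring ℚ.+-*-ring)
  using (sum-syntax; ∑-distrib-+; ∑-comm; *-distribˡ-sum; *-distribʳ-sum; sum-cong-≗; sum-replicate-zero)

ℚ-ring : AlmostCommutativeRing _ _
ℚ-ring = fromCommutativeRing ℚ.+-*-commutativeRing (dec⇒maybe ∘ (0ℚ ℚ.≟_))

-2ℚ : ℚ
-2ℚ = - (1ℚ + 1ℚ)

sq : ℚ → ℚ
sq p = p * p

sq-nonNeg : ∀ p → 0ℚ ≤ℚ sq p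
sq-nonNeg p with ℚ.≤-total 0ℚ p
... | inj₁ 0≤p = ℚ.≤-trans (ℚ.≤-reflexive (sym (ℚ.*-zeroʳ p)))
                   (ℚ.*-monoˡ-≤-nonNeg p {{Q.nonNegative 0≤p}} 0≤p)
... | inj₂ p≤0 = ℚ.≤-trans (ℚ.≤-reflexive (sym (ℚ.*-zeroʳ p)))
                   (ℚ.*-monoˡ-≤-nonPos p {{Q.nonPositive p≤0}} p≤0)

-- Finite sums

∑-zero : ∀ n {g : Fin n → ℚ} → (∀ i → g i ≡ 0ℚ) → ∑[ i < n ] g i ≡ 0ℚ
∑-zero n g≡0 = trans (sum-cong-≗ g≡0) (sum-replicate-zero n)

∑-nonPos : ∀ n (g : Fin n → ℚ) → (∀ i → g i ≤ℚ 0ℚ) → ∑[ i < n ] g i ≤ℚ 0ℚ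
∑-nonPos zero    g g≤0 = ℚ.≤-refl
∑-nonPos (suc n) g g≤0 = ℚ.+-mono-≤ (g≤0 Fin.zero) (∑-nonPos n (g ∘ Fin.suc) (g≤0 ∘ Fin.suc))

sumFin≡∑ : ∀ n (g : Fin n → ℚ) → sumFin n g ≡ ∑[ i < n ] g i
sumFin≡∑ zero    g = refl
sumFin≡∑ (suc n) g = cong (g Fin.zero +_) (sumFin≡∑ n (g ∘ Fin.suc))

sumV≡∑ : ∀ m n (g : Vertex m n → ℚ) → sumV m n g ≡ ∑[ i < m ℕ.+ n ] g (splitAt m i)
sumV≡∑ zero    n g = trans (ℚ.+-identityˡ _) (sumFin≡∑ n (g ∘ inj₂))
sumV≡∑ (suc m) n g = trans (ℚ.+-assoc (g (inj₁ Fin.zero)) _ _)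
  (cong (g (inj₁ Fin.zero) +_) (sumV≡∑ m n (g ∘ Sum.map₁ Fin.suc)))

sumV-split : ∀ m n (g : Vertex m n → ℚ) → sumV m n g ≡ ∑[ i < m ] g (inj₁ i) + ∑[ j < n ] g (inj₂ j)
sumV-split m n g = cong₂ _+_ (sumFin≡∑ m (g ∘ inj₁)) (sumFin≡∑ n (g ∘ inj₂))

module _ {m n : ℕ} where

  sumV-cong : ∀ {g h : Vertex m n → ℚ} → (∀ x → g x ≡ h x) → sumV m n g ≡ sumV m n h
  sumV-cong {g} {h} g≗h =
    trans (sumV≡∑ m n g) (trans (sum-cong-≗ (g≗h ∘ splitAt m)) (sym (sumV≡∑ m n h)))

  sumV-distrib-+ : ∀ (g h : Vertex m n → ℚ) → sumV m n (λ x → g x + h x) ≡ sumV m n g + sumV m n h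
  sumV-distrib-+ g h = begin
    sumV m n (λ x → g x + h x)
      ≡⟨ sumV≡∑ m n (λ x → g x + h x) ⟩
    ∑[ i < m ℕ.+ n ] (g (splitAt m i) + h (splitAt m i))
      ≡⟨ ∑-distrib-+ (g ∘ splitAt m) (h ∘ splitAt m) ⟩
    ∑[ i < m ℕ.+ n ] g (splitAt m i) + ∑[ i < m ℕ.+ n ] h (splitAt m i)
      ≡⟨ sym (cong₂ _+_ (sumV≡∑ m n g) (sumV≡∑ m n h)) ⟩
    sumV m n g + sumV m n h ∎
    where open ≡-Reasoning

  *-distribˡ-sumV : ∀ c (g : Vertex m n → ℚ) → c * sumV m n g ≡ sumV m n (λ x → c * g x)
  *-distribˡ-sumV c g = trans (cong (c *_) (sumV≡∑ m n g))
    (trans (*-distribˡ-sum c (g ∘ splitAt m)) (sym (sumV≡∑ m n (λ x → c * g x))))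

  *-distribʳ-sumV : ∀ c (g : Vertex m n → ℚ) → sumV m n g * c ≡ sumV m n (λ x → g x * c)
  *-distribʳ-sumV c g = trans (cong (_* c) (sumV≡∑ m n g))
    (trans (*-distribʳ-sum c (g ∘ splitAt m)) (sym (sumV≡∑ m n (λ x → g x * c))))

  sumV-comm-∑ : ∀ K (g : Vertex m n → Fin K → ℚ) →
    sumV m n (λ x → ∑[ k < K ] g x k) ≡ ∑[ k < K ] sumV m n (λ x → g x k)
  sumV-comm-∑ K g = trans (sumV≡∑ m n (λ x → ∑[ k < K ] g x k))
    (trans (∑-comm (g ∘ splitAt m)) (sum-cong-≗ {K} (λ k → sym (sumV≡∑ m n (λ x → g x k)))))

  sumV-comm : ∀ m′ n′ (g : Vertex m n → Vertex m′ n′ → ℚ) →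
    sumV m n (λ x → sumV m′ n′ (g x)) ≡ sumV m′ n′ (λ p → sumV m n (λ x → g x p))
  sumV-comm m′ n′ g = begin
    sumV m n (λ x → sumV m′ n′ (g x))
      ≡⟨ sumV-cong (λ x → sumV≡∑ m′ n′ (g x)) ⟩
    sumV m n (λ x → ∑[ i < m′ ℕ.+ n′ ] g x (splitAt m′ i))
      ≡⟨ sumV-comm-∑ (m′ ℕ.+ n′) (λ x → g x ∘ splitAt m′) ⟩
    ∑[ i < m′ ℕ.+ n′ ] sumV m n (λ x → g x (splitAt m′ i))
      ≡⟨ sym (sumV≡∑ m′ n′ (λ p → sumV m n (λ x → g x p))) ⟩
    sumV m′ n′ (λ p → sumV m n (λ x → g x p)) ∎
    where open ≡-Reasoning

δ : ∀ {n} → Fin n → Fin n → ℚ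
δ Fin.zero    Fin.zero    = 1ℚ
δ Fin.zero    (Fin.suc _) = 0ℚ
δ (Fin.suc _) Fin.zero    = 0ℚ
δ (Fin.suc i) (Fin.suc j) = δ i j

∑-δ : ∀ {n} (i : Fin n) (g : Fin n → ℚ) → ∑[ j < n ] (δ i j * g j) ≡ g i
∑-δ {suc n} Fin.zero g = begin
  1ℚ * g Fin.zero + ∑[ j < n ] (0ℚ * g (Fin.suc j))
    ≡⟨ cong₂ _+_ (ℚ.*-identityˡ (g Fin.zero)) (∑-zero n (ℚ.*-zeroˡ ∘ g ∘ Fin.suc)) ⟩
  g Fin.zero + 0ℚ
    ≡⟨ ℚ.+-identityʳ _ ⟩
  g Fin.zero ∎
  where open ≡-Reasoning
∑-δ {suc n} (Fin.suc i) g =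
  trans (cong₂ _+_ (ℚ.*-zeroˡ (g Fin.zero)) (∑-δ i (g ∘ Fin.suc))) (ℚ.+-identityˡ _)

δV : ∀ {m n} → Vertex m n → Vertex m n → ℚ
δV (inj₁ i) (inj₁ j) = δ i j
δV (inj₂ i) (inj₂ j) = δ i j
δV (inj₁ _) (inj₂ _) = 0ℚ
δV (inj₂ _) (inj₁ _) = 0ℚ

sumV-δV : ∀ {m n} (p : Vertex m n) (g : Vertex m n → ℚ) → sumV m n (λ x → δV p x * g x) ≡ g p
sumV-δV {m} {n} (inj₁ i) g = begin
  sumV m n (λ x → δV (inj₁ i) x * g x)
    ≡⟨ sumV-split m n (λ x → δV (inj₁ i) x * g x) ⟩
  ∑[ j < m ] (δ i j * g (inj₁ j)) + ∑[ j < n ] (0ℚ * g (inj₂ j))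
    ≡⟨ cong₂ _+_ (∑-δ i (g ∘ inj₁)) (∑-zero n (ℚ.*-zeroˡ ∘ g ∘ inj₂)) ⟩
  g (inj₁ i) + 0ℚ
    ≡⟨ ℚ.+-identityʳ _ ⟩
  g (inj₁ i) ∎
  where open ≡-Reasoning
sumV-δV {m} {n} (inj₂ j) g = begin
  sumV m n (λ x → δV (inj₂ j) x * g x)
    ≡⟨ sumV-split m n (λ x → δV (inj₂ j) x * g x) ⟩
  ∑[ i < m ] (0ℚ * g (inj₁ i)) + ∑[ i < n ] (δ j i * g (inj₂ i))
    ≡⟨ cong₂ _+_ (∑-zero m (ℚ.*-zeroˡ ∘ g ∘ inj₁)) (∑-δ j (g ∘ inj₂)) ⟩
  0ℚ + g (inj₂ j)
    ≡⟨ ℚ.+-identityˡ _ ⟩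
  g (inj₂ j) ∎
  where open ≡-Reasoning

-- Quadratic forms of distance matrices

-- QE-K m n t asks for quadForm m n (λ x y → ℕ→ℚ (d x y)) f ≤ 0 (definitionally).
quadForm : ∀ m n → (Vertex m n → Vertex m n → ℚ) → (Vertex m n → ℚ) → ℚ
quadForm m n D f = sumV m n (λ x → sumV m n (λ y → f x * D x y * f y))

sqDistance : {V : Set} → ∀ K → (Fin K → ℚ) → (Fin K → V → ℚ) → V → V → ℚ
sqDistance K w φ x y = ∑[ k < K ] (w k * sq (φ k x - φ k y))

module _ {m n : ℕ} where

  quadForm-cong : ∀ {D E} f → (∀ x y → D x y ≡ E x y) → quadForm m n D f ≡ quadForm m n E f
  quadForm-cong f D≡E = sumV-cong (λ x → sumV-cong (λ y → cong (λ d → f x * d * f y) (D≡E x y)))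

  quadForm≡nested : ∀ D f → quadForm m n D f ≡ sumV m n (λ x → f x * sumV m n (λ y → f y * D x y))
  quadForm≡nested D f = sumV-cong λ x → begin
    sumV m n (λ y → f x * D x y * f y)    ≡⟨ sumV-cong (λ y → rearrange (f x) (D x y) (f y)) ⟩
    sumV m n (λ y → f x * (f y * D x y))  ≡⟨ sym (*-distribˡ-sumV (f x) (λ y → f y * D x y)) ⟩
    f x * sumV m n (λ y → f y * D x y)    ∎
    where
    open ≡-Reasoning
    rearrange : ∀ a d b → a * d * b ≡ a * (b * d)
    rearrange = solve-∀ ℚ-ring

  quadForm-+ : ∀ D E f → quadForm m n (λ x y → D x y + E x y) f ≡ quadForm m n D f + quadForm m n E f
  quadForm-+ D E f = begin
    quadForm m n (λ x y → D x y + E x y) f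
      ≡⟨ sumV-cong (λ x → sumV-cong (λ y → distrib (f x) (D x y) (E x y) (f y))) ⟩
    sumV m n (λ x → sumV m n (λ y → f x * D x y * f y + f x * E x y * f y))
      ≡⟨ sumV-cong (λ x → sumV-distrib-+ (λ y → f x * D x y * f y) (λ y → f x * E x y * f y)) ⟩
    sumV m n (λ x → sumV m n (λ y → f x * D x y * f y) + sumV m n (λ y → f x * E x y * f y))
      ≡⟨ sumV-distrib-+ (λ x → sumV m n (λ y → f x * D x y * f y))
                        (λ x → sumV m n (λ y → f x * E x y * f y)) ⟩
    quadForm m n D f + quadForm m n E f ∎
    where
    open ≡-Reasoning
    distrib : ∀ a d e b → a * (d + e) * b ≡ a * d * b + a * e * b
    distrib = solve-∀ ℚ-ring

  quadForm-*ˡ : ∀ c E f → quadForm m n (λ x y → c * E x y) f ≡ c * quadForm m n E f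
  quadForm-*ˡ c E f = begin
    quadForm m n (λ x y → c * E x y) f
      ≡⟨ sumV-cong (λ x → sumV-cong (λ y → pull (f x) c (E x y) (f y))) ⟩
    sumV m n (λ x → sumV m n (λ y → c * (f x * E x y * f y)))
      ≡⟨ sumV-cong (λ x → sym (*-distribˡ-sumV c (λ y → f x * E x y * f y))) ⟩
    sumV m n (λ x → c * sumV m n (λ y → f x * E x y * f y))
      ≡⟨ sym (*-distribˡ-sumV c (λ x → sumV m n (λ y → f x * E x y * f y))) ⟩
    c * quadForm m n E f ∎
    where
    open ≡-Reasoning
    pull : ∀ a c e b → a * (c * e) * b ≡ c * (a * e * b)
    pull = solve-∀ ℚ-ring

  quadForm-∑ : ∀ K (E : Fin K → Vertex m n → Vertex m n → ℚ) f →
    quadForm m n (λ x y → ∑[ k < K ] E k x y) f ≡ ∑[ k < K ] quadForm m n (E k) f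
  quadForm-∑ K E f = begin
    quadForm m n (λ x y → ∑[ k < K ] E k x y) f
      ≡⟨ sumV-cong (λ x → sumV-cong (λ y → distrib (f x) (f y) (λ k → E k x y))) ⟩
    sumV m n (λ x → sumV m n (λ y → ∑[ k < K ] (f x * E k x y * f y)))
      ≡⟨ sumV-cong (λ x → sumV-comm-∑ K (λ y k → f x * E k x y * f y)) ⟩
    sumV m n (λ x → ∑[ k < K ] sumV m n (λ y → f x * E k x y * f y))
      ≡⟨ sumV-comm-∑ K (λ x k → sumV m n (λ y → f x * E k x y * f y)) ⟩
    ∑[ k < K ] quadForm m n (E k) f ∎
    where
    open ≡-Reasoning
    distrib : ∀ a b (e : Fin K → ℚ) → a * ∑[ k < K ] e k * b ≡ ∑[ k < K ] (a * e k * b)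
    distrib a b e = trans (cong (_* b) (*-distribˡ-sum a e)) (*-distribʳ-sum b (λ k → a * e k))

  quadForm-rankOne : ∀ (p q f : Vertex m n → ℚ) →
    quadForm m n (λ x y → p x * q y) f ≡ sumV m n (λ x → f x * p x) * sumV m n (λ y → f y * q y)
  quadForm-rankOne p q f = begin
    quadForm m n (λ x y → p x * q y) f
      ≡⟨ sumV-cong (λ x → sumV-cong (λ y → regroup (f x) (p x) (q y) (f y))) ⟩
    sumV m n (λ x → sumV m n (λ y → f x * p x * (f y * q y)))
      ≡⟨ sumV-cong (λ x → sym (*-distribˡ-sumV (f x * p x) (λ y → f y * q y))) ⟩
    sumV m n (λ x → f x * p x * sumV m n (λ y → f y * q y))
      ≡⟨ sym (*-distribʳ-sumV (sumV m n (λ y → f y * q y)) (λ x → f x * p x)) ⟩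
    sumV m n (λ x → f x * p x) * sumV m n (λ y → f y * q y) ∎
    where
    open ≡-Reasoning
    regroup : ∀ a b c d → a * (b * c) * d ≡ a * b * (d * c)
    regroup = solve-∀ ℚ-ring

  -- (a x − a y)² splits into three rank-one kernels, two of which die against ∑ f = 0.
  quadForm-sqDiff : ∀ (a f : Vertex m n → ℚ) → sumV m n f ≡ 0ℚ →
    quadForm m n (λ x y → sq (a x - a y)) f ≡ -2ℚ * sq (sumV m n (λ x → f x * a x))
  quadForm-sqDiff a f ∑f≡0 = begin
    quadForm m n (λ x y → sq (a x - a y)) f
      ≡⟨ quadForm-cong f (λ x y → expand (a x) (a y)) ⟩
    quadForm m n (λ x y → K₁ x y + (K₂ x y + K₃ x y)) f
      ≡⟨ trans (quadForm-+ K₁ (λ x y → K₂ x y + K₃ x y) f)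
               (cong (quadForm m n K₁ f +_) (quadForm-+ K₂ K₃ f)) ⟩
    quadForm m n K₁ f + (quadForm m n K₂ f + quadForm m n K₃ f)
      ≡⟨ cong₂ _+_ (quadForm-rankOne (sq ∘ a) (λ _ → 1ℚ) f)
           (cong₂ _+_ (quadForm-rankOne (λ _ → 1ℚ) (sq ∘ a) f) (quadForm-rankOne ((-2ℚ *_) ∘ a) a f)) ⟩
    B * S + (S * B + C * A)
      ≡⟨ cong (λ s → B * s + (s * B + C * A)) S≡0 ⟩
    B * 0ℚ + (0ℚ * B + C * A)
      ≡⟨ cancel B (C * A) ⟩
    C * A
      ≡⟨ cong (_* A) C≡-2A ⟩
    -2ℚ * A * A
      ≡⟨ ℚ.*-assoc -2ℚ A A ⟩
    -2ℚ * sq A ∎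
    where
    open ≡-Reasoning
    A B C S : ℚ
    A = sumV m n (λ x → f x * a x)
    B = sumV m n (λ x → f x * sq (a x))
    C = sumV m n (λ x → f x * (-2ℚ * a x))
    S = sumV m n (λ x → f x * 1ℚ)
    K₁ K₂ K₃ : Vertex m n → Vertex m n → ℚ
    K₁ x y = sq (a x) * 1ℚ
    K₂ x y = 1ℚ * sq (a y)
    K₃ x y = (-2ℚ * a x) * a y
    expand : ∀ u v → (u - v) * (u - v) ≡ u * u * 1ℚ + (1ℚ * (v * v) + (- (1ℚ + 1ℚ) * u) * v)
    expand = solve-∀ ℚ-ring
    cancel : ∀ b z → b * 0ℚ + (0ℚ * b + z) ≡ z
    cancel = solve-∀ ℚ-ring
    swap : ∀ c u v → u * (c * v) ≡ c * (u * v)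
    swap = solve-∀ ℚ-ring
    S≡0 : S ≡ 0ℚ
    S≡0 = trans (sumV-cong (λ x → ℚ.*-identityʳ (f x))) ∑f≡0
    C≡-2A : C ≡ -2ℚ * A
    C≡-2A = trans (sumV-cong (λ x → swap -2ℚ (f x) (a x))) (sym (*-distribˡ-sumV -2ℚ (λ x → f x * a x)))

  quadForm-sqDistance-nonPos : ∀ K (w : Fin K → ℚ) (φ : Fin K → Vertex m n → ℚ) →
    (∀ k → 0ℚ ≤ℚ w k) → ∀ f → sumV m n f ≡ 0ℚ → quadForm m n (sqDistance K w φ) f ≤ℚ 0ℚ
  quadForm-sqDistance-nonPos K w φ w≥0 f ∑f≡0 = begin
    quadForm m n (sqDistance K w φ) f
      ≡⟨ quadForm-∑ K (λ k x y → w k * sq (φ k x - φ k y)) f ⟩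
    ∑[ k < K ] quadForm m n (λ x y → w k * sq (φ k x - φ k y)) f
      ≡⟨ sum-cong-≗ (λ k → trans (quadForm-*ˡ (w k) (λ x y → sq (φ k x - φ k y)) f)
                                  (cong (w k *_) (quadForm-sqDiff (φ k) f ∑f≡0))) ⟩
    ∑[ k < K ] (w k * (-2ℚ * sq (A k)))
      ≤⟨ ∑-nonPos K (λ k → w k * (-2ℚ * sq (A k))) term≤0 ⟩
    0ℚ ∎
    where
    open ℚ.≤-Reasoning
    A : Fin K → ℚ
    A k = sumV m n (λ x → f x * φ k x)
    term≤0 : ∀ k → w k * (-2ℚ * sq (A k)) ≤ℚ 0ℚ
    term≤0 k = begin
      w k * (-2ℚ * sq (A k))
        ≤⟨ ℚ.*-monoˡ-≤-nonNeg (w k) {{Q.nonNegative (w≥0 k)}}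
             (ℚ.*-monoˡ-≤-nonPos -2ℚ (sq-nonNeg (A k))) ⟩
      w k * (-2ℚ * 0ℚ)  ≡⟨ cong (w k *_) (ℚ.*-zeroʳ -2ℚ) ⟩
      w k * 0ℚ          ≡⟨ ℚ.*-zeroʳ (w k) ⟩
      0ℚ                ∎

module _ {m′ n′ m n : ℕ} (ι : Vertex m′ n′ → Vertex m n) where

  spread : (Vertex m′ n′ → ℚ) → Vertex m n → ℚ
  spread c x = sumV m′ n′ (λ p → c p * δV (ι p) x)

  sumV-spread-* : ∀ c g → sumV m n (λ x → spread c x * g x) ≡ sumV m′ n′ (λ p → c p * g (ι p))
  sumV-spread-* c g = begin
    sumV m n (λ x → spread c x * g x)
      ≡⟨ sumV-cong (λ x → *-distribʳ-sumV (g x) (λ p → c p * δV (ι p) x)) ⟩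
    sumV m n (λ x → sumV m′ n′ (λ p → c p * δV (ι p) x * g x))
      ≡⟨ sumV-cong (λ x → sumV-cong (λ p → ℚ.*-assoc (c p) (δV (ι p) x) (g x))) ⟩
    sumV m n (λ x → sumV m′ n′ (λ p → c p * (δV (ι p) x * g x)))
      ≡⟨ sumV-comm m′ n′ (λ x p → c p * (δV (ι p) x * g x)) ⟩
    sumV m′ n′ (λ p → sumV m n (λ x → c p * (δV (ι p) x * g x)))
      ≡⟨ sumV-cong (λ p → sym (*-distribˡ-sumV (c p) (λ x → δV (ι p) x * g x))) ⟩
    sumV m′ n′ (λ p → c p * sumV m n (λ x → δV (ι p) x * g x))
      ≡⟨ sumV-cong (λ p → cong (c p *_) (sumV-δV (ι p) g)) ⟩
    sumV m′ n′ (λ p → c p * g (ι p)) ∎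
    where open ≡-Reasoning

  sumV-spread : ∀ c → sumV m n (spread c) ≡ sumV m′ n′ c
  sumV-spread c = begin
    sumV m n (spread c)               ≡⟨ sumV-cong (λ x → sym (ℚ.*-identityʳ (spread c x))) ⟩
    sumV m n (λ x → spread c x * 1ℚ)  ≡⟨ sumV-spread-* c (λ _ → 1ℚ) ⟩
    sumV m′ n′ (λ p → c p * 1ℚ)       ≡⟨ sumV-cong (λ p → ℚ.*-identityʳ (c p)) ⟩
    sumV m′ n′ c                      ∎
    where open ≡-Reasoning

  quadForm-spread : ∀ D c → quadForm m n D (spread c) ≡ quadForm m′ n′ (λ p q → D (ι p) (ι q)) c
  quadForm-spread D c = begin
    quadForm m n D (spread c)
      ≡⟨ quadForm≡nested D (spread c) ⟩
    sumV m n (λ x → spread c x * sumV m n (λ y → spread c y * D x y))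
      ≡⟨ sumV-spread-* c (λ x → sumV m n (λ y → spread c y * D x y)) ⟩
    sumV m′ n′ (λ p → c p * sumV m n (λ y → spread c y * D (ι p) y))
      ≡⟨ sumV-cong (λ p → cong (c p *_) (sumV-spread-* c (D (ι p)))) ⟩
    sumV m′ n′ (λ p → c p * sumV m′ n′ (λ q → c q * D (ι p) (ι q)))
      ≡⟨ sym (quadForm≡nested (λ p q → D (ι p) (ι q)) c) ⟩
    quadForm m′ n′ (λ p q → D (ι p) (ι q)) c ∎
    where open ≡-Reasoning

-- Walks and graph distances

ShortestWalk : {V : Set} → (V → V → Set) → V → V → ℕ → Set
ShortestWalk A x y k = Walk A x y k × (∀ {j} → j ℕ.< k → ¬ Walk A x y j)

module _ {V : Set} {A : V → V → Set} where

  shortest⇒isGraphDistance : {d : V → V → ℕ} →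
    (∀ x y → ShortestWalk A x y (d x y)) → IsGraphDistance A d
  shortest⇒isGraphDistance shortest x y =
    proj₁ (shortest x y) , λ k walk → ℕP.≮⇒≥ (λ k<d → proj₂ (shortest x y) k<d walk)

  shortest⇒connected : {d : V → V → ℕ} → (∀ x y → ShortestWalk A x y (d x y)) → Connected A
  shortest⇒connected {d} shortest x y = d x y , proj₁ (shortest x y)

  graphDistance-unique : ∀ {d x y k} → IsGraphDistance A d → ShortestWalk A x y k → d x y ≡ k
  graphDistance-unique {x = x} {y} {k} isDist (walk , noShorter) =
    ℕP.≤-antisym (proj₂ (isDist x y) k walk) (ℕP.≮⇒≥ (λ d<k → noShorter d<k (proj₁ (isDist x y))))

  shortest-here : ∀ {x} → ShortestWalk A x x 0
  shortest-here = here , λ ()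

  shortest-edge : ∀ {x y} → x ≢ y → A x y → ShortestWalk A x y 1
  shortest-edge x≢y xy = step xy here , λ { (s≤s z≤n) here → x≢y refl }

  shortest-twoSteps : ∀ {x y z} → x ≢ y → ¬ A x y → A x z → A z y → ShortestWalk A x y 2
  shortest-twoSteps x≢y ¬xy xz zy = step xz (step zy here) , λ
    { (s≤s z≤n)       here           → x≢y refl
    ; (s≤s (s≤s z≤n)) (step xy here) → ¬xy xy
    }

  closedSet⇒¬connected : (P : V → Set) → (∀ {x y} → A x y → P x → P y) →
    ∀ {x y} → P x → ¬ P y → ¬ Connected A
  closedSet⇒¬connected P closed {x} {y} Px ¬Py connected = ¬Py (along (proj₂ (connected x y)) Px)
    where
    along : ∀ {a b k} → Walk A a b k → P a → P b
    along here        Pa = Pa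
    along (step ab w) Pa = along w (closed ab Pa)

connected-QE-sqDistance : ∀ {m n t} (d : Vertex m n → Vertex m n → ℕ) →
  (∀ x y → ShortestWalk (Adj m n t) x y (d x y)) →
  ∀ K (w : Fin K → ℚ) (φ : Fin K → Vertex m n → ℚ) → (∀ k → 0ℚ ≤ℚ w k) →
  (∀ x y → ℕ→ℚ (d x y) ≡ sqDistance K w φ x y) → Connected (Adj m n t) × QE-K m n t
connected-QE-sqDistance d shortest K w φ w≥0 d≡ =
  shortest⇒connected shortest , d , shortest⇒isGraphDistance shortest ,
  λ f ∑f≡0 → ℚ.≤-trans (ℚ.≤-reflexive (quadForm-cong f d≡))
                        (quadForm-sqDistance-nonPos K w φ w≥0 f ∑f≡0)

-- Complete bipartite subgraphs

completeBipartiteDistance : ∀ {m n} → Vertex m n → Vertex m n → ℕ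
completeBipartiteDistance (inj₁ i) (inj₁ j) = if does (i Fin.≟ j) then 0 else 2
completeBipartiteDistance (inj₂ i) (inj₂ j) = if does (i Fin.≟ j) then 0 else 2
completeBipartiteDistance (inj₁ _) (inj₂ _) = 1
completeBipartiteDistance (inj₂ _) (inj₁ _) = 1

record CompleteSubgraph (m′ n′ m n t : ℕ) : Set where
  field
    left            : Fin m′ → Fin m
    right           : Fin n′ → Fin n
    left-injective  : Injective _≡_ _≡_ left
    right-injective : Injective _≡_ _≡_ right
    adjacent        : ∀ i j → Adj m n t (inj₁ (left i)) (inj₂ (right j))

  embed : Vertex m′ n′ → Vertex m n
  embed = Sum.map left right

completeBipartite : ∀ m n → CompleteSubgraph m n m n 0
completeBipartite m n = record
  { left = id ; right = id ; left-injective = id ; right-injective = id ; adjacent = λ _ _ _ → z≤n }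

module _ {m′ n′ m n t : ℕ} (H : CompleteSubgraph (suc m′) (suc n′) m n t) where
  open CompleteSubgraph H

  shortest-embed : ∀ p q → ShortestWalk (Adj m n t) (embed p) (embed q) (completeBipartiteDistance p q)
  shortest-embed (inj₁ i) (inj₁ j) with i Fin.≟ j
  ... | yes refl = shortest-here
  ... | no  i≢j  = shortest-twoSteps {z = inj₂ (right Fin.zero)}
                     (i≢j ∘ left-injective ∘ Sum.inj₁-injective) (λ ())
                     (adjacent i Fin.zero) (adjacent j Fin.zero)
  shortest-embed (inj₂ i) (inj₂ j) with i Fin.≟ j
  ... | yes refl = shortest-here
  ... | no  i≢j  = shortest-twoSteps {z = inj₁ (left Fin.zero)}
                     (i≢j ∘ right-injective ∘ Sum.inj₂-injective) (λ ())
                     (adjacent Fin.zero i) (adjacent Fin.zero j)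
  shortest-embed (inj₁ i) (inj₂ j) = shortest-edge (λ ()) (adjacent i j)
  shortest-embed (inj₂ i) (inj₁ j) = shortest-edge (λ ()) (adjacent j i)

completeBipartite-shortest : ∀ m n (p q : Vertex (suc m) (suc n)) →
  ShortestWalk (Adj (suc m) (suc n) 0) p q (completeBipartiteDistance p q)
completeBipartite-shortest m n p q =
  subst₂ (λ x y → ShortestWalk _ x y (completeBipartiteDistance p q)) (Sum.map-id p) (Sum.map-id q)
    (shortest-embed (completeBipartite (suc m) (suc n)) p q)

QE-K-completeSubgraph : ∀ {m′ n′ m n t} → CompleteSubgraph (suc m′) (suc n′) m n t →
  QE-K m n t → QE-K (suc m′) (suc n′) 0
QE-K-completeSubgraph {m′} {n′} {m} {n} H (d , isDist , qe) =
  completeBipartiteDistance , shortest⇒isGraphDistance (completeBipartite-shortest m′ n′) ,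
  λ c ∑c≡0 → begin
    quadForm (suc m′) (suc n′) (λ p q → ℕ→ℚ (completeBipartiteDistance p q)) c
      ≡⟨ quadForm-cong c (λ p q → cong ℕ→ℚ (sym (graphDistance-unique isDist (shortest-embed H p q)))) ⟩
    quadForm (suc m′) (suc n′) (λ p q → D (embed p) (embed q)) c
      ≡⟨ sym (quadForm-spread embed D c) ⟩
    quadForm m n D (spread embed c)
      ≤⟨ qe (spread embed c) (trans (sumV-spread embed c) ∑c≡0) ⟩
    0ℚ ∎
  where
  open CompleteSubgraph H
  open ℚ.≤-Reasoning
  D : Vertex m n → Vertex m n → ℚ
  D x y = ℕ→ℚ (d x y)

¬QE-K₂₃ : ¬ QE-K 2 3 0
¬QE-K₂₃ (d , isDist , qe) = ℚ.<-irrefl refl (ℚ.<-≤-trans 0<Q (qe c refl))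
  where
  c : Vertex 2 3 → ℚ
  c (inj₁ _) = ℕ→ℚ 3
  c (inj₂ _) = - ℕ→ℚ 2
  -- The form evaluates to 36 + 48 − 72 = 12.
  0<Q : 0ℚ Q.< quadForm 2 3 (λ p q → ℕ→ℚ (d p q)) c
  0<Q = subst (0ℚ Q.<_)
    (quadForm-cong c λ p q →
      cong ℕ→ℚ (sym (graphDistance-unique isDist (completeBipartite-shortest 1 2 p q))))
    (ℚ.positive⁻¹ _)

∑-sq-0-δ : ∀ {n} (j : Fin n) → ∑[ k < n ] (1ℚ * sq (0ℚ - δ j k)) ≡ 1ℚ
∑-sq-0-δ {suc n} Fin.zero    = cong (1ℚ * sq (0ℚ - 1ℚ) +_) (∑-zero n (λ _ → refl))
∑-sq-0-δ {suc n} (Fin.suc j) = cong (1ℚ * sq (0ℚ - 0ℚ) +_) (∑-sq-0-δ j)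

∑-sq-δ-0 : ∀ {n} (j : Fin n) → ∑[ k < n ] (1ℚ * sq (δ j k - 0ℚ)) ≡ 1ℚ
∑-sq-δ-0 {suc n} Fin.zero    = cong (1ℚ * sq (1ℚ - 0ℚ) +_) (∑-zero n (λ _ → refl))
∑-sq-δ-0 {suc n} (Fin.suc j) = cong (1ℚ * sq (0ℚ - 0ℚ) +_) (∑-sq-δ-0 j)

∑-sq-δ-δ : ∀ {n} (i j : Fin n) →
  ∑[ k < n ] (1ℚ * sq (δ i k - δ j k)) ≡ ℕ→ℚ (if does (i Fin.≟ j) then 0 else 2)
∑-sq-δ-δ {suc n} Fin.zero    Fin.zero    = cong (1ℚ * sq (1ℚ - 1ℚ) +_) (∑-zero n (λ _ → refl))
∑-sq-δ-δ {suc n} Fin.zero    (Fin.suc j) = cong (1ℚ * sq (1ℚ - 0ℚ) +_) (∑-sq-0-δ j)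
∑-sq-δ-δ {suc n} (Fin.suc i) Fin.zero    = cong (1ℚ * sq (0ℚ - 1ℚ) +_) (∑-sq-δ-0 i)
∑-sq-δ-δ {suc n} (Fin.suc i) (Fin.suc j) =
  trans (cong (1ℚ * sq (0ℚ - 0ℚ) +_) (∑-sq-δ-δ i j)) (ℚ.+-identityˡ _)

starCoordinate : ∀ {n} → Fin n → Vertex 1 n → ℚ
starCoordinate k (inj₁ _) = 0ℚ
starCoordinate k (inj₂ j) = δ j k

star-sqDistance : ∀ n (x y : Vertex 1 n) →
  ℕ→ℚ (completeBipartiteDistance x y) ≡ sqDistance n (λ _ → 1ℚ) starCoordinate x y
star-sqDistance n (inj₁ 0F) (inj₁ 0F) = sym (∑-zero n (λ _ → refl))
star-sqDistance n (inj₁ 0F) (inj₂ j)  = sym (∑-sq-0-δ j)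
star-sqDistance n (inj₂ i)  (inj₁ 0F) = sym (∑-sq-δ-0 i)
star-sqDistance n (inj₂ i)  (inj₂ j)  = sym (∑-sq-δ-δ i j)

star-connected-QE : ∀ n → Connected (Adj 1 (suc n) 0) × QE-K 1 (suc n) 0
star-connected-QE n = connected-QE-sqDistance completeBipartiteDistance (completeBipartite-shortest 0 n)
  (suc n) (λ _ → 1ℚ) starCoordinate (λ _ → ℚ.nonNegative⁻¹ 1ℚ) (star-sqDistance (suc n))

K¹₁ₙ-disconnected : ∀ n → ¬ Connected (Adj 1 (suc n) 1)
K¹₁ₙ-disconnected n = closedSet⇒¬connected (_≡ inj₂ 0F) closed {y = inj₁ 0F} refl (λ ())
  where
  closed : ∀ {x y} → Adj 1 (suc n) 1 x y → x ≡ inj₂ 0F → y ≡ inj₂ 0F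
  closed {y = inj₁ 0F} v₀u₀ refl with () ← v₀u₀ refl

K²₂₂-disconnected : ¬ Connected (Adj 2 2 2)
K²₂₂-disconnected = closedSet⇒¬connected Component closed {inj₁ 0F} {inj₁ 1F} tt (λ ())
  where
  Component : Vertex 2 2 → Set
  Component (inj₁ 0F) = ⊤
  Component (inj₂ 1F) = ⊤
  Component _         = ⊥
  closed : ∀ {x y} → Adj 2 2 2 x y → Component x → Component y
  closed {inj₁ 0F} {inj₂ 0F} u₀v₀ _ with () ← u₀v₀ refl
  closed {inj₁ 0F} {inj₂ 1F} _    _ = tt
  closed {inj₂ 1F} {inj₁ 0F} _    _ = tt
  closed {inj₂ 1F} {inj₁ 1F} u₁v₁ _ with s≤s () ← u₁v₁ refl

-- Small graphs by evaluation

module _ {m n : ℕ} where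

  all? : {P : Vertex m n → Set} → (∀ x → Dec (P x)) → Dec (∀ x → P x)
  all? P? = map′ (λ (l , r) → Sum.[ l , r ]) (λ h → h ∘ inj₁ , h ∘ inj₂)
    (FinP.all? (P? ∘ inj₁) ×-dec FinP.all? (P? ∘ inj₂))

  any? : {P : Vertex m n → Set} → (∀ x → Dec (P x)) → Dec (∃ P)
  any? P? = map′ Sum.[ (λ (i , p) → inj₁ i , p) , (λ (j , p) → inj₂ j , p) ]
    (λ { (inj₁ i , p) → inj₁ (i , p) ; (inj₂ j , p) → inj₂ (j , p) })
    (FinP.any? (P? ∘ inj₁) ⊎-dec FinP.any? (P? ∘ inj₂))

module _ {m n t : ℕ} where

  adjacent? : ∀ x y → Dec (Adj m n t x y)
  adjacent? (inj₁ i) (inj₂ j) = (Fin.toℕ i ℕ.≟ Fin.toℕ j) →-dec (t ℕ.≤? Fin.toℕ i)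
  adjacent? (inj₂ j) (inj₁ i) = (Fin.toℕ i ℕ.≟ Fin.toℕ j) →-dec (t ℕ.≤? Fin.toℕ i)
  adjacent? (inj₁ _) (inj₁ _) = no λ ()
  adjacent? (inj₂ _) (inj₂ _) = no λ ()

  walk? : ∀ k x y → Dec (Walk (Adj m n t) x y k)
  walk? zero    x y = map′ (λ { refl → here }) (λ { here → refl }) (Sum.≡-dec Fin._≟_ Fin._≟_ x y)
  walk? (suc k) x y = map′ (λ (z , xz , w) → step xz w) (λ { (step xz w) → _ , xz , w })
    (any? (λ z → adjacent? x z ×-dec walk? k z y))

  shortestWalk? : ∀ x y k → Dec (ShortestWalk (Adj m n t) x y k)
  shortestWalk? x y k = walk? k x y ×-dec ℕP.allUpTo? (λ j → ¬? (walk? j x y)) k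

  firstWalkLength : ℕ → Vertex m n → Vertex m n → ℕ → ℕ
  firstWalkLength zero       x y k = k
  firstWalkLength (suc fuel) x y k = if does (walk? k x y) then k else firstWalkLength fuel x y (suc k)

  -- The least k < 4 admitting a walk of length k, and 4 otherwise; certificate? below checks that
  -- this is the graph distance.
  walkDistance : Vertex m n → Vertex m n → ℕ
  walkDistance x y = firstWalkLength 4 x y 0

module _ {m n t K : ℕ} (w : Vec ℚ K) (U : Vec (Vec ℕ K) m) (W : Vec (Vec ℕ K) n) where

  coordinate : Fin K → Vertex m n → ℚ
  coordinate k (inj₁ i) = ℕ→ℚ (lookup (lookup U i) k)
  coordinate k (inj₂ j) = ℕ→ℚ (lookup (lookup W j) k)

  private
    d : Vertex m n → Vertex m n → ℕ
    d = walkDistance {t = t}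

  certificate? : Dec ((∀ x y → ShortestWalk (Adj m n t) x y (d x y))
                     × (∀ k → 0ℚ ≤ℚ lookup w k)
                     × (∀ x y → ℕ→ℚ (d x y) ≡ sqDistance K (lookup w) coordinate x y))
  certificate? = all? (λ x → all? (λ y → shortestWalk? x y (d x y)))
    ×-dec FinP.all? (λ k → 0ℚ ℚ.≤? lookup w k)
    ×-dec all? (λ x → all? (λ y → ℕ→ℚ (d x y) ℚ.≟ sqDistance K (lookup w) coordinate x y))

  connected-QE-byComputation : {True certificate?} → Connected (Adj m n t) × QE-K m n t
  connected-QE-byComputation {ok} = let (shortest , w≥0 , d≡) = toWitness ok in
    connected-QE-sqDistance d shortest K (lookup w) coordinate w≥0 d≡

K⁰₂₂-connected-QE : Connected (Adj 2 2 0) × QE-K 2 2 0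
K⁰₂₂-connected-QE = connected-QE-byComputation (ℤ.+ 1 / 2 ∷ ℤ.+ 1 / 2 ∷ [])
  ((0 ∷ 1 ∷ []) ∷ (2 ∷ 1 ∷ []) ∷ [])
  ((1 ∷ 2 ∷ []) ∷ (1 ∷ 0 ∷ []) ∷ [])

K¹₂₂-connected-QE : Connected (Adj 2 2 1) × QE-K 2 2 1
K¹₂₂-connected-QE = connected-QE-byComputation (ℤ.+ 1 / 2 ∷ 1ℚ ∷ ℤ.+ 1 / 2 ∷ [])
  ((0 ∷ 0 ∷ 0 ∷ []) ∷ (2 ∷ 0 ∷ 0 ∷ []) ∷ [])
  ((2 ∷ 1 ∷ 0 ∷ []) ∷ (1 ∷ 0 ∷ 1 ∷ []) ∷ [])

K¹₂₃-connected-QE : Connected (Adj 2 3 1) × QE-K 2 3 1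
K¹₂₃-connected-QE = connected-QE-byComputation (ℤ.+ 1 / 2 ∷ 1ℚ ∷ ℤ.+ 1 / 2 ∷ [])
  ((0 ∷ 0 ∷ 1 ∷ []) ∷ (2 ∷ 0 ∷ 1 ∷ []) ∷ [])
  ((2 ∷ 1 ∷ 1 ∷ []) ∷ (1 ∷ 0 ∷ 2 ∷ []) ∷ (1 ∷ 0 ∷ 0 ∷ []) ∷ [])

K²₂₃-connected-QE : Connected (Adj 2 3 2) × QE-K 2 3 2
K²₂₃-connected-QE = connected-QE-byComputation (ℤ.+ 1 / 2 ∷ 1ℚ ∷ 1ℚ ∷ ℤ.+ 1 / 2 ∷ [])
  ((0 ∷ 0 ∷ 0 ∷ 0 ∷ []) ∷ (2 ∷ 0 ∷ 0 ∷ 0 ∷ []) ∷ [])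
  ((2 ∷ 1 ∷ 0 ∷ 0 ∷ []) ∷ (0 ∷ 0 ∷ 1 ∷ 0 ∷ []) ∷ (1 ∷ 0 ∷ 0 ∷ 1 ∷ []) ∷ [])

K²₂₄-connected-QE : Connected (Adj 2 4 2) × QE-K 2 4 2
K²₂₄-connected-QE = connected-QE-byComputation (ℤ.+ 1 / 2 ∷ 1ℚ ∷ 1ℚ ∷ ℤ.+ 1 / 2 ∷ [])
  ((0 ∷ 0 ∷ 0 ∷ 1 ∷ []) ∷ (2 ∷ 0 ∷ 0 ∷ 1 ∷ []) ∷ [])
  ((2 ∷ 1 ∷ 0 ∷ 1 ∷ []) ∷ (0 ∷ 0 ∷ 1 ∷ 1 ∷ []) ∷
   (1 ∷ 0 ∷ 0 ∷ 2 ∷ []) ∷ (1 ∷ 0 ∷ 0 ∷ 0 ∷ []) ∷ [])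

K²₃₃-connected-QE : Connected (Adj 3 3 2) × QE-K 3 3 2
K²₃₃-connected-QE = connected-QE-byComputation (ℤ.+ 1 / 2 ∷ ℤ.+ 1 / 6 ∷ ℤ.+ 1 / 3 ∷ [])
  ((0 ∷ 0 ∷ 1 ∷ []) ∷ (2 ∷ 0 ∷ 1 ∷ []) ∷ (1 ∷ 3 ∷ 1 ∷ []) ∷ [])
  ((2 ∷ 2 ∷ 2 ∷ []) ∷ (0 ∷ 2 ∷ 2 ∷ []) ∷ (1 ∷ 1 ∷ 0 ∷ []) ∷ [])

K³₃₃-connected-QE : Connected (Adj 3 3 3) × QE-K 3 3 3
K³₃₃-connected-QE = connected-QE-byComputation (ℤ.+ 1 / 2 ∷ ℤ.+ 1 / 6 ∷ ℤ.+ 1 / 3 ∷ [])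
  ((0 ∷ 1 ∷ 0 ∷ []) ∷ (2 ∷ 1 ∷ 0 ∷ []) ∷ (1 ∷ 4 ∷ 0 ∷ []) ∷ [])
  ((2 ∷ 3 ∷ 1 ∷ []) ∷ (0 ∷ 3 ∷ 1 ∷ []) ∷ (1 ∷ 0 ∷ 1 ∷ []) ∷ [])

K³₃₄-connected-QE : Connected (Adj 3 4 3) × QE-K 3 4 3
K³₃₄-connected-QE = connected-QE-byComputation (ℤ.+ 1 / 2 ∷ ℤ.+ 1 / 6 ∷ ℤ.+ 1 / 3 ∷ [])
  ((0 ∷ 1 ∷ 1 ∷ []) ∷ (2 ∷ 1 ∷ 1 ∷ []) ∷ (1 ∷ 4 ∷ 1 ∷ []) ∷ [])
  ((2 ∷ 3 ∷ 2 ∷ []) ∷ (0 ∷ 3 ∷ 2 ∷ []) ∷ (1 ∷ 0 ∷ 2 ∷ []) ∷ (1 ∷ 2 ∷ 0 ∷ []) ∷ [])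

K⁴₄₄-connected-QE : Connected (Adj 4 4 4) × QE-K 4 4 4
K⁴₄₄-connected-QE = connected-QE-byComputation (ℤ.+ 1 / 2 ∷ ℤ.+ 1 / 6 ∷ ℤ.+ 1 / 3 ∷ [])
  ((0 ∷ 1 ∷ 1 ∷ []) ∷ (2 ∷ 1 ∷ 1 ∷ []) ∷ (1 ∷ 4 ∷ 1 ∷ []) ∷ (1 ∷ 2 ∷ 3 ∷ []) ∷ [])
  ((2 ∷ 3 ∷ 2 ∷ []) ∷ (0 ∷ 3 ∷ 2 ∷ []) ∷ (1 ∷ 0 ∷ 2 ∷ []) ∷ (1 ∷ 2 ∷ 0 ∷ []) ∷ [])

injective? : ∀ {k N} (f : Fin k → Fin N) → Dec (∀ i j → f i ≡ f j → i ≡ j)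
injective? f = FinP.all? λ i → FinP.all? λ j → (f i Fin.≟ f j) →-dec (i Fin.≟ j)

completeSubgraph : ∀ {m′ n′ m n t} (left : Vec (Fin m) m′) (right : Vec (Fin n) n′) →
  {True (injective? (lookup left) ×-dec injective? (lookup right) ×-dec
          FinP.all? λ i → FinP.all? λ j →
            adjacent? {t = t} (inj₁ (lookup left i)) (inj₂ (lookup right j)))} →
  CompleteSubgraph m′ n′ m n t
completeSubgraph left right {ok} = let (left-inj , right-inj , adj) = toWitness ok in record
  { left = lookup left ; right = lookup right
  ; left-injective = left-inj _ _ ; right-injective = right-inj _ _ ; adjacent = adj }

classify : ∀ {m n t} → t ≤ m → m ≤ n → 1 ≤ m →
  InList m n t ⊎ CompleteSubgraph 2 3 m n t ⊎ ¬ Connected (Adj m n t)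
classify {1} {n}     {0} _ 1≤n _ = inj₁ (star 1≤n)
classify {1} {suc n} {1} _ _   _ = inj₂ (inj₂ (K¹₁ₙ-disconnected n))
classify {suc (suc m)} {suc (suc (suc (suc (suc n))))} _ _ _ =
  inj₂ (inj₁ (completeSubgraph (# 0 ∷ # 1 ∷ []) (# 2 ∷ # 3 ∷ # 4 ∷ [])))
classify {2} {2} {0} _ _ _ = inj₁ k220
classify {2} {2} {1} _ _ _ = inj₁ k221
classify {2} {2} {2} _ _ _ = inj₂ (inj₂ K²₂₂-disconnected)
classify {2} {3} {0} _ _ _ = inj₂ (inj₁ (completeSubgraph (# 0 ∷ # 1 ∷ []) (# 0 ∷ # 1 ∷ # 2 ∷ [])))
classify {2} {3} {1} _ _ _ = inj₁ k231
classify {2} {3} {2} _ _ _ = inj₁ k232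
classify {2} {4} {0} _ _ _ = inj₂ (inj₁ (completeSubgraph (# 0 ∷ # 1 ∷ []) (# 1 ∷ # 2 ∷ # 3 ∷ [])))
classify {2} {4} {1} _ _ _ = inj₂ (inj₁ (completeSubgraph (# 0 ∷ # 1 ∷ []) (# 1 ∷ # 2 ∷ # 3 ∷ [])))
classify {2} {4} {2} _ _ _ = inj₁ k242
classify {3} {3} {0} _ _ _ = inj₂ (inj₁ (completeSubgraph (# 1 ∷ # 2 ∷ []) (# 0 ∷ # 1 ∷ # 2 ∷ [])))
classify {3} {3} {1} _ _ _ = inj₂ (inj₁ (completeSubgraph (# 1 ∷ # 2 ∷ []) (# 0 ∷ # 1 ∷ # 2 ∷ [])))
classify {3} {3} {2} _ _ _ = inj₁ k332
classify {3} {3} {3} _ _ _ = inj₁ k333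
classify {3} {4} {0} _ _ _ = inj₂ (inj₁ (completeSubgraph (# 1 ∷ # 2 ∷ []) (# 0 ∷ # 2 ∷ # 3 ∷ [])))
classify {3} {4} {1} _ _ _ = inj₂ (inj₁ (completeSubgraph (# 1 ∷ # 2 ∷ []) (# 0 ∷ # 2 ∷ # 3 ∷ [])))
classify {3} {4} {2} _ _ _ = inj₂ (inj₁ (completeSubgraph (# 1 ∷ # 2 ∷ []) (# 0 ∷ # 2 ∷ # 3 ∷ [])))
classify {3} {4} {3} _ _ _ = inj₁ k343
classify {4} {4} {0} _ _ _ = inj₂ (inj₁ (completeSubgraph (# 2 ∷ # 3 ∷ []) (# 0 ∷ # 1 ∷ # 3 ∷ [])))
classify {4} {4} {1} _ _ _ = inj₂ (inj₁ (completeSubgraph (# 2 ∷ # 3 ∷ []) (# 0 ∷ # 1 ∷ # 3 ∷ [])))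
classify {4} {4} {2} _ _ _ = inj₂ (inj₁ (completeSubgraph (# 2 ∷ # 3 ∷ []) (# 0 ∷ # 1 ∷ # 3 ∷ [])))
classify {4} {4} {3} _ _ _ = inj₂ (inj₁ (completeSubgraph (# 2 ∷ # 3 ∷ []) (# 0 ∷ # 1 ∷ # 3 ∷ [])))
classify {4} {4} {4} _ _ _ = inj₁ k444
classify {0} _ _ ()
classify {1} {0} {1} _ () _
classify {1} {_} {suc (suc _)} (s≤s ()) _ _
classify {suc (suc _)} {0} _ () _
classify {suc (suc _)} {1} _ (s≤s ()) _
classify {suc (suc (suc _))} {2} _ (s≤s (s≤s ())) _
classify {suc (suc (suc (suc _)))} {3} _ (s≤s (s≤s (s≤s ()))) _
classify {suc (suc (suc (suc (suc _))))} {4} _ (s≤s (s≤s (s≤s (s≤s ())))) _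
classify {2} {_} {suc (suc (suc _))} (s≤s (s≤s ())) _ _
classify {3} {_} {suc (suc (suc (suc _)))} (s≤s (s≤s (s≤s ()))) _ _
classify {4} {_} {suc (suc (suc (suc (suc _))))} (s≤s (s≤s (s≤s (s≤s ())))) _ _

InList⇒connected-QE : ∀ {m n t} → InList m n t → Connected (Adj m n t) × QE-K m n t
InList⇒connected-QE (star {suc n} _) = star-connected-QE n
InList⇒connected-QE k220 = K⁰₂₂-connected-QE
InList⇒connected-QE k221 = K¹₂₂-connected-QE
InList⇒connected-QE k231 = K¹₂₃-connected-QE
InList⇒connected-QE k232 = K²₂₃-connected-QE
InList⇒connected-QE k242 = K²₂₄-connected-QE
InList⇒connected-QE k332 = K²₃₃-connected-QE
InList⇒connected-QE k333 = K³₃₃-connected-QE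
InList⇒connected-QE k343 = K³₃₄-connected-QE
InList⇒connected-QE k444 = K⁴₄₄-connected-QE

corollary2p4 : (m n t : ℕ) → t ≤ m → m ≤ n → 1 ≤ m →
    ((Connected (Adj m n t) × QE-K m n t) ⇔ InList m n t)
corollary2p4 m n t t≤m m≤n 1≤m = mk⇔ listed InList⇒connected-QE
  where
  listed : Connected (Adj m n t) × QE-K m n t → InList m n t
  listed (connected , qe) with classify t≤m m≤n 1≤m
  ... | inj₁ inList              = inList
  ... | inj₂ (inj₁ K₂₃⊆K)        = ⊥-elim (¬QE-K₂₃ (QE-K-completeSubgraph K₂₃⊆K qe))
  ... | inj₂ (inj₂ disconnected) = ⊥-elim (disconnected connected)
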